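{- Let $\sigma\in\mathfrak S_n$ be a cycle (a single cycle of length $n$), and let $\tau=\Phi(\sigma)$. Then $$\ell_S(\sigma)=n-1+2\big([2,31]+[14,23]+[41,32]\big)(\tau),$$ $$\mathrm{dp}(\sigma)=n-1+\big([2,31]+[14,23]+[41,32]+[24,13]+[31,42]\big)(\tau)=\frac{\ell_S(\sigma)+\ell_T(\sigma)}{2}+\big([31,42]+[24,13]\big)(\tau).$$ In particular, $\sigma$ is shallow if and only if $\tau$ avoids the vincular patterns $31,42$ and $24,13$.
   Context: $\ell_S(\sigma)$ is the number of inversions; $\ell_T(\sigma)=n-(\text{number of cycles of }\sigma)$; $\mathrm{dp}(\sigma)=\sum_{i:\sigma_i>i}(\sigma_i-i)$; $\sigma$ is shallow if $\mathrm{dp}(\sigma)=(\ell_S(\sigma)+\ell_T(\sigma))/2$. The fundamental bijection $\Phi$: write $\sigma$ in cycle notation with each cycle beginning with its largest element and cycles ordered by increasing largest element; erasing parentheses gives the one-line notation of $\Phi(\sigma)$. Pattern counts on $\tau\in\mathfrak S_n$: $[2,31](\tau)$ = number of pairs of positions $i<j$ with $\tau_{j+1}<\tau_i<\tau_j$; and for the four-letter patterns, counting pairs of positions $i,j$ with $i+1<j$: $[14,23]$: $\tau_i<\tau_j<\tau_{j+1}<\tau_{i+1}$; $[41,32]$: $\tau_{i+1}<\tau_{j+1}<\tau_j<\tau_i$; $[24,13]$: $\tau_j<\tau_i<\tau_{j+1}<\tau_{i+1}$; $[31,42]$: $\tau_{i+1}<\tau_{j+1}<\tau_i<\tau_j$.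 $\tau$ avoids a pattern if its count is $0$. -}

module Defs where

open import Data.Nat using (ℕ; zero; suc; _+_; _*_; _∸_; _<ᵇ_; _≤ᵇ_; _≡ᵇ_)
open import Data.Bool using (Bool; true; false; _∧_; not; if_then_else_)
open import Data.Fin using (Fin; toℕ)
open import Data.Fin.Permutation using (Permutation′; _⟨$⟩ʳ_)
open import Data.List using (List; []; _∷_; map; upTo; allFin; filter; concatMap; length)
open import Data.Nat.ListAction using (sum)
open import Data.Bool.ListAction using (all)
open import Relation.Nullary.Decidable using (Dec; yes; no)
open import Data.Bool.Properties using () renaming (_≟_ to _≟ᵇ_)

countᵇ : {A : Set} → (A → Bool) → List A → ℕ
countᵇ p [] = 0
countᵇ p (x ∷ xs) = (if p x then 1 else 0) + countᵇ p xs

iter : ∀ {n} → Permutation′ n → ℕ → Fin n → Fin n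
iter σ zero i = i
iter σ (suc k) i = σ ⟨$⟩ʳ (iter σ k i)

-- Statistics on σ ∈ 𝔖_n  (values/positions 0-indexed; all statistics
-- used are invariant under the shift by one)

ℓS : ∀ {n} → Permutation′ n → ℕ
ℓS {n} σ = sum (map (λ i → countᵇ (λ j → (toℕ i <ᵇ toℕ j) ∧ (toℕ (σ ⟨$⟩ʳ j) <ᵇ toℕ (σ ⟨$⟩ʳ i))) (allFin n)) (allFin n))

isCycleMax : ∀ {n} → Permutation′ n → Fin n → Bool
isCycleMax {n} σ i = all (λ k → toℕ (iter σ k i) ≤ᵇ toℕ i) (upTo n)

cycles : ∀ {n} → Permutation′ n → ℕ
cycles {n} σ = countᵇ (isCycleMax σ) (allFin n)

ℓT : ∀ {n} → Permutation′ n → ℕ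
ℓT {n} σ = n ∸ cycles σ

-- dp(σ) = Σ_{σ_i > i} (σ_i − i)   (truncated subtraction gives 0 otherwise)
dp : ∀ {n} → Permutation′ n → ℕ
dp {n} σ = sum (map (λ i → toℕ (σ ⟨$⟩ʳ i) ∸ toℕ i) (allFin n))

IsCycle : ∀ {n} → Permutation′ n → Set
IsCycle σ = cycles σ ≡ 1
  where open import Relation.Binary.PropositionalEquality using (_≡_)

-- shallow: dp(σ) = (ℓ_S(σ) + ℓ_T(σ)) / 2, stated without division
IsShallow : ∀ {n} → Permutation′ n → Set
IsShallow σ = 2 * dp σ ≡ ℓS σ + ℓT σ
  where open import Relation.Binary.PropositionalEquality using (_≡_)

-- The fundamental bijection Φ, producing the one-line notation of Φ(σ)
-- as a list of values (0-indexed).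

takeWhileᵇ : {A : Set} → (A → Bool) → List A → List A
takeWhileᵇ p [] = []
takeWhileᵇ p (x ∷ xs) = if p x then x ∷ takeWhileᵇ p xs else []

eqFin : ∀ {n} → Fin n → Fin n → Bool
eqFin a b = toℕ a ≡ᵇ toℕ b

cycleFrom : ∀ {n} → Permutation′ n → Fin n → List (Fin n)
cycleFrom {n} σ m = m ∷ takeWhileᵇ (λ x → not (eqFin x m)) (map (λ k → iter σ (suc k) m) (upTo n))

-- cycles each starting with their maximum, ordered by increasing maximum,
-- parentheses erased
Φ : ∀ {n} → Permutation′ n → List ℕ
Φ {n} σ = map toℕ (concatMap (cycleFrom σ) (filter (λ m → isCycleMax σ m ≟ᵇ true) (allFin n)))

-- Vincular pattern counts on a word τ = τ_0 τ_1 … τ_{L-1} (0-indexed positions)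

at : List ℕ → ℕ → ℕ
at [] _ = 0
at (x ∷ xs) zero = x
at (x ∷ xs) (suc k) = at xs k

countPairs : (ℕ → ℕ → Bool) → List ℕ → ℕ
countPairs p τ = sum (map (λ i → countᵇ (λ j → (i <ᵇ j) ∧ ((suc j <ᵇ length τ) ∧ p i j)) (upTo (length τ))) (upTo (length τ)))

p2-31 : List ℕ → ℕ
p2-31 τ = countPairs (λ i j → (at τ (suc j) <ᵇ at τ i) ∧ (at τ i <ᵇ at τ j)) τ

p14-23 : List ℕ → ℕ
p14-23 τ = countPairs (λ i j → (suc i <ᵇ j) ∧ ((at τ i <ᵇ at τ j) ∧ ((at τ j <ᵇ at τ (suc j)) ∧ (at τ (suc j) <ᵇ at τ (suc i))))) τ

p41-32 : List ℕ → ℕ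
p41-32 τ = countPairs (λ i j → (suc i <ᵇ j) ∧ ((at τ (suc i) <ᵇ at τ (suc j)) ∧ ((at τ (suc j) <ᵇ at τ j) ∧ (at τ j <ᵇ at τ i)))) τ

p24-13 : List ℕ → ℕ
p24-13 τ = countPairs (λ i j → (suc i <ᵇ j) ∧ ((at τ j <ᵇ at τ i) ∧ ((at τ i <ᵇ at τ (suc j)) ∧ (at τ (suc j) <ᵇ at τ (suc i))))) τ

p31-42 : List ℕ → ℕ
p31-42 τ = countPairs (λ i j → (suc i <ᵇ j) ∧ ((at τ (suc i) <ᵇ at τ (suc j)) ∧ ((at τ (suc j) <ᵇ at τ i) ∧ (at τ i <ᵇ at τ j)))) τ

Avoids : (List ℕ → ℕ) → List ℕ → Set
Avoids pat τ = pat τ ≡ 0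
  where open import Relation.Binary.PropositionalEquality using (_≡_)

-- Write the cycle σ as the cyclic word τ = Φ(σ): τ 0 = n - 1 is its largest letter and σ (τ k) = τ (k + 1), indices
-- taken modulo n. Then ℓ_T(σ) = n - 1, while ℓ_S(σ) and dp(σ) become statistics of the arrows τ k ↦ τ (k + 1). Both
-- formulas are proved for every prefix τ 0 … τ m, read as the cycle (τ 0 … τ m), by induction on m: appending
-- x = τ (m + 1) after p = τ m replaces the arrow p ↦ τ 0 by p ↦ x ↦ τ 0. The resulting change is a sum, over the
-- older arrows a ↦ b, of local terms that depend only on the relative order of a, b, p, x and τ 0, so the identities
-- between them can be verified on the finitely many order types. The terms counting arrows that cross the level x
-- telescope, and what remains are exactly the new pattern occurrences with j = m. The shallowness criterion is then
-- arithmetic.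

module Submission where

open import Defs
open import Data.Bool using (Bool; true; false; _∧_; _∨_; not; T; if_then_else_)
open import Data.Bool.ListAction using (all)
open import Data.Bool.Properties using (T?; T-∧) renaming (_≟_ to _≟ᵇ_)
open import Data.Fin using (Fin; zero; suc; toℕ; fromℕ; fromℕ<; #_)
import Data.Fin.Properties as Fin
open import Data.Fin.Permutation using (Permutation′; _⟨$⟩ʳ_; _⟨$⟩ˡ_; inverseˡ)
open import Data.List using ([]; _∷_; _++_; map; applyUpTo; upTo; tabulate; allFin; filter; concatMap)
import Data.List.Properties as List
import Data.List.Relation.Unary.All.Properties as All
open import Data.Nat
open import Data.Nat.ListAction using (sum)
open import Data.Nat.Properties
open import Data.Nat.Tactic.RingSolver using (solve-∀)
open import Data.Product using (∃-syntax; _×_; _,_; proj₁; proj₂)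
open import Data.Sum using (inj₁; inj₂)
open import Data.Unit using (tt)
open import Function using (case_of_; Injective)
open import Function.Bundles using (Equivalence; _⇔_; mk⇔)
open import Relation.Binary using (tri<; tri≈; tri>)
open import Relation.Binary.PropositionalEquality
open import Relation.Nullary using (yes; no; contradiction)
open import Relation.Nullary.Decidable using (Dec; True; toWitness)
open import Relation.Unary using (Decidable)

𝟙 : Bool → ℕ
𝟙 true = 1
𝟙 false = 0

𝟙[b∧false]≡0 : ∀ b → 𝟙 (b ∧ false) ≡ 0
𝟙[b∧false]≡0 true = refl
𝟙[b∧false]≡0 false = refl

<⇒<ᵇ≡true : ∀ {m n} → m < n → (m <ᵇ n) ≡ true
<⇒<ᵇ≡true {m} {n} m<n with m <ᵇ n | <⇒<ᵇ m<n
... | true | _ = refl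

≥⇒<ᵇ≡false : ∀ {m n} → n ≤ m → (m <ᵇ n) ≡ false
≥⇒<ᵇ≡false {m} {n} n≤m with m <ᵇ n in eq
... | false = refl
... | true = contradiction (<ᵇ⇒< m n (subst T (sym eq) _)) (≤⇒≯ n≤m)

n<ᵇn≡false : ∀ n → (n <ᵇ n) ≡ false
n<ᵇn≡false n = ≥⇒<ᵇ≡false (≤-refl {n})

∑< : ℕ → (ℕ → ℕ) → ℕ
∑< zero g = 0
∑< (suc n) g = ∑< n g + g n

syntax ∑< n (λ k → e) = ∑[ k < n ] e

∑-cong : ∀ n {g h : ℕ → ℕ} → (∀ k → k < n → g k ≡ h k) → ∑< n g ≡ ∑< n h
∑-cong zero e = refl
∑-cong (suc n) e = cong₂ _+_ (∑-cong n (λ k k<n → e k (m<n⇒m<1+n k<n))) (e n ≤-refl)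

∑-zero : ∀ n (g : ℕ → ℕ) → (∀ k → k < n → g k ≡ 0) → ∑< n g ≡ 0
∑-zero zero g e = refl
∑-zero (suc n) g e = cong₂ _+_ (∑-zero n g (λ k k<n → e k (m<n⇒m<1+n k<n))) (e n ≤-refl)

∑-distrib-+ : ∀ n (g h : ℕ → ℕ) → ∑[ k < n ] (g k + h k) ≡ ∑< n g + ∑< n h
∑-distrib-+ zero g h = refl
∑-distrib-+ (suc n) g h =
  trans (cong (_+ (g n + h n)) (∑-distrib-+ n g h)) (interchange (∑< n g) (∑< n h) (g n) (h n))
  where
  interchange : ∀ a b c d → (a + b) + (c + d) ≡ (a + c) + (b + d)
  interchange = solve-∀

∑-distribˡ-* : ∀ n c (g : ℕ → ℕ) → ∑[ k < n ] (c * g k) ≡ c * ∑< n g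
∑-distribˡ-* zero c g = sym (*-zeroʳ c)
∑-distribˡ-* (suc n) c g =
  trans (cong (_+ c * g n) (∑-distribˡ-* n c g)) (sym (*-distribˡ-+ c (∑< n g) (g n)))

∑-suc : ∀ n (g : ℕ → ℕ) → ∑< (suc n) g ≡ g 0 + ∑[ k < n ] g (suc k)
∑-suc zero g = sym (+-identityʳ (g 0))
∑-suc (suc n) g = trans (cong (_+ g (suc n)) (∑-suc n g)) (+-assoc (g 0) _ _)

∑-single : ∀ n (g : ℕ → ℕ) k₀ → k₀ < n → (∀ k → k < n → k ≢ k₀ → g k ≡ 0) → ∑< n g ≡ g k₀
∑-single (suc n) g k₀ k₀<1+n others with k₀ ≟ n
... | yes refl = cong (_+ g n) (∑-zero n g (λ k k<n → others k (m<n⇒m<1+n k<n) (<⇒≢ k<n)))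
... | no k₀≢n = trans
  (cong₂ _+_ (∑-single n g k₀ (≤∧≢⇒< (≤-pred k₀<1+n) k₀≢n) (λ k k<n → others k (m<n⇒m<1+n k<n)))
             (others n ≤-refl (≢-sym k₀≢n)))
  (+-identityʳ (g k₀))

∑-comm : ∀ n m (h : ℕ → ℕ → ℕ) → ∑[ i < n ] ∑[ j < m ] h i j ≡ ∑[ j < m ] ∑[ i < n ] h i j
∑-comm zero m h = sym (∑-zero m (λ _ → 0) (λ _ _ → refl))
∑-comm (suc n) m h =
  trans (cong (_+ ∑< m (h n)) (∑-comm n m h)) (sym (∑-distrib-+ m (λ j → ∑[ i < n ] h i j) (h n)))

∑∑-suc : ∀ n (h : ℕ → ℕ → ℕ) →
  ∑[ k < suc n ] ∑< (suc n) (h k) ≡ (∑[ k < n ] ∑< n (h k) + ∑[ k < n ] (h k n + h n k)) + h n n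
∑∑-suc n h = begin
    ∑[ k < n ] (∑< n (h k) + h k n) + (∑< n (h n) + h n n)
  ≡⟨ cong (_+ (∑< n (h n) + h n n)) (∑-distrib-+ n (λ k → ∑< n (h k)) (λ k → h k n)) ⟩
    (∑[ k < n ] ∑< n (h k) + ∑[ k < n ] h k n) + (∑< n (h n) + h n n)
  ≡⟨ regroup (∑[ k < n ] ∑< n (h k)) (∑[ k < n ] h k n) (∑< n (h n)) (h n n) ⟩
    (∑[ k < n ] ∑< n (h k) + (∑[ k < n ] h k n + ∑< n (h n))) + h n n
  ≡⟨ cong (λ z → (∑[ k < n ] ∑< n (h k) + z) + h n n) (sym (∑-distrib-+ n (λ k → h k n) (h n))) ⟩
    (∑[ k < n ] ∑< n (h k) + ∑[ k < n ] (h k n + h n k)) + h n n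
  ∎
  where
  open ≡-Reasoning
  regroup : ∀ a b c e → (a + b) + (c + e) ≡ (a + (b + c)) + e
  regroup = solve-∀

∑-distrib-+₃ : ∀ n (g h i : ℕ → ℕ) → ∑[ k < n ] (g k + h k + i k) ≡ ∑< n g + ∑< n h + ∑< n i
∑-distrib-+₃ n g h i = trans (∑-distrib-+ n (λ k → g k + h k) i) (cong (_+ ∑< n i) (∑-distrib-+ n g h))

crossings-balance : ∀ (q : ℕ → Bool) m →
  ∑[ k < m ] 𝟙 (q k ∧ not (q (suc k))) + 𝟙 (q m) ≡ ∑[ k < m ] 𝟙 (not (q k) ∧ q (suc k)) + 𝟙 (q 0)
crossings-balance q zero = refl
crossings-balance q (suc m) = begin
    (leaves + 𝟙 (q m ∧ not (q (suc m)))) + 𝟙 (q (suc m))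
  ≡⟨ +-assoc leaves _ _ ⟩
    leaves + (𝟙 (q m ∧ not (q (suc m))) + 𝟙 (q (suc m)))
  ≡⟨ cong (leaves +_) (one-step (q m) (q (suc m))) ⟩
    leaves + (𝟙 (not (q m) ∧ q (suc m)) + 𝟙 (q m))
  ≡⟨ regroup leaves _ _ ⟩
    (leaves + 𝟙 (q m)) + 𝟙 (not (q m) ∧ q (suc m))
  ≡⟨ cong (_+ 𝟙 (not (q m) ∧ q (suc m))) (crossings-balance q m) ⟩
    (enters + 𝟙 (q 0)) + 𝟙 (not (q m) ∧ q (suc m))
  ≡⟨ +-assoc enters _ _ ⟩
    enters + (𝟙 (q 0) + 𝟙 (not (q m) ∧ q (suc m)))
  ≡⟨ regroup enters _ _ ⟩
    (enters + 𝟙 (not (q m) ∧ q (suc m))) + 𝟙 (q 0)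
  ∎
  where
  open ≡-Reasoning
  leaves = ∑[ k < m ] 𝟙 (q k ∧ not (q (suc k)))
  enters = ∑[ k < m ] 𝟙 (not (q k) ∧ q (suc k))
  one-step : ∀ a b → 𝟙 (a ∧ not b) + 𝟙 b ≡ 𝟙 (not a ∧ b) + 𝟙 a
  one-step true true = refl
  one-step true false = refl
  one-step false true = refl
  one-step false false = refl
  regroup : ∀ u a b → u + (a + b) ≡ (u + b) + a
  regroup = solve-∀

inInterval : ℕ → ℕ → ℕ → Bool
inInterval u v w = not (w <ᵇ u) ∧ (w <ᵇ v)

inInterval-split : ∀ c {u w v} → u ≤ w → w ≤ v →
  𝟙 (inInterval u w c) + 𝟙 (inInterval w v c) ≡ 𝟙 (inInterval u v c)
inInterval-split c {u} {w} {v} u≤w w≤v with <-cmp c w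
... | tri< c<w _ _ rewrite <⇒<ᵇ≡true c<w | <⇒<ᵇ≡true (<-≤-trans c<w w≤v) = +-identityʳ _
... | tri≈ _ refl _ rewrite n<ᵇn≡false c | ≥⇒<ᵇ≡false u≤w = refl
... | tri> _ _ w<c rewrite ≥⇒<ᵇ≡false (<⇒≤ w<c) | ≥⇒<ᵇ≡false (≤-trans u≤w (<⇒≤ w<c)) = refl

inInterval-empty : ∀ c {u v} → v ≤ u → 𝟙 (inInterval u v c) ≡ 0
inInterval-empty c {u} {v} v≤u with c <? u
... | yes c<u rewrite <⇒<ᵇ≡true c<u = refl
... | no c≮u rewrite ≥⇒<ᵇ≡false (≤-trans v≤u (≮⇒≥ c≮u)) = 𝟙[b∧false]≡0 (not (c <ᵇ u))

not[<ᵇ]≡>ᵇ : ∀ {u v} → u ≢ v → not (u <ᵇ v) ≡ (v <ᵇ u)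
not[<ᵇ]≡>ᵇ {u} {v} u≢v with <-cmp u v
... | tri< u<v _ _ rewrite <⇒<ᵇ≡true u<v | ≥⇒<ᵇ≡false (<⇒≤ u<v) = refl
... | tri≈ _ u≡v _ = contradiction u≡v u≢v
... | tri> _ _ v<u rewrite <⇒<ᵇ≡true v<u | ≥⇒<ᵇ≡false (<⇒≤ v<u) = refl

-- Appending the letter x after the last letter p of a cyclic word with first (and largest) letter M replaces the
-- arrow p ↦ M by p ↦ x ↦ M. These are the contributions of one older arrow a ↦ b, at positions k and k + 1, to
-- the resulting changes; g records k + 1 < m, where m is the position of p.
module LocalCounts (g a<x x<a a<p p<a b<x x<b p<x x<p M<b b<M : Bool) where

  new2-31 new14-23 new41-32 new24-13 new31-42 : ℕ
  new2-31 = 𝟙 (x<a ∧ a<p)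
  new14-23 = 𝟙 (g ∧ (a<p ∧ (p<x ∧ x<b)))
  new41-32 = 𝟙 (g ∧ (b<x ∧ (x<p ∧ p<a)))
  new24-13 = 𝟙 (g ∧ (p<a ∧ (a<x ∧ x<b)))
  new31-42 = 𝟙 (g ∧ (b<x ∧ (x<a ∧ a<p)))

  invertedPX invertedXM invertedPM : ℕ
  invertedPX = 𝟙 (a<p ∧ x<b) + 𝟙 (p<a ∧ b<x)
  invertedXM = 𝟙 (a<x ∧ M<b) + 𝟙 (x<a ∧ b<M)
  invertedPM = 𝟙 (a<p ∧ M<b) + 𝟙 (p<a ∧ b<M)

  leavesBelowX entersBelowX leavesAboveX entersAboveX : ℕ
  leavesBelowX = 𝟙 (a<x ∧ not b<x)
  entersBelowX = 𝟙 (not a<x ∧ b<x)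
  leavesAboveX = 𝟙 (x<a ∧ not x<b)
  entersAboveX = 𝟙 (not x<a ∧ x<b)

  new-three new-five : ℕ
  new-three = new2-31 + new14-23 + new41-32
  new-five = new-three + new24-13 + new31-42

  inversions-x<p inversions-p<x displacement-x<p displacement-p<x : Bool
  inversions-x<p =
    (invertedPX + invertedXM + entersBelowX) ≡ᵇ (invertedPM + 2 * new-three + leavesBelowX)
  inversions-p<x =
    (invertedPX + invertedXM + entersAboveX) ≡ᵇ (invertedPM + 2 * new-three + leavesAboveX)
  displacement-x<p = (entersAboveX + entersBelowX + new2-31) ≡ᵇ (new-five + leavesBelowX)
  displacement-p<x = entersAboveX ≡ᵇ new-five

Comparisons : Set
Comparisons = Bool × Bool × Bool × Bool

compare₂ : ℕ → ℕ → ℕ → Comparisons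
compare₂ lo hi v = (v <ᵇ lo) , (lo <ᵇ v) , (v <ᵇ hi) , (hi <ᵇ v)

-- Only the order type of v relative to lo < hi matters, and it is one of five.
compare₂-collapse : ∀ {lo hi} → lo < hi → ∀ v → ∃[ s ] compare₂ lo hi v ≡ compare₂ 1 3 (toℕ {5} s)
compare₂-collapse {lo} {hi} lo<hi v with <-cmp v lo
... | tri< v<lo _ _
  rewrite <⇒<ᵇ≡true v<lo | ≥⇒<ᵇ≡false (<⇒≤ v<lo)
        | <⇒<ᵇ≡true (<-trans v<lo lo<hi) | ≥⇒<ᵇ≡false (<⇒≤ (<-trans v<lo lo<hi)) = # 0 , refl
... | tri≈ _ refl _
  rewrite n<ᵇn≡false v | <⇒<ᵇ≡true lo<hi | ≥⇒<ᵇ≡false (<⇒≤ lo<hi) = # 1 , refl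
... | tri> _ _ lo<v with <-cmp v hi
...   | tri< v<hi _ _ rewrite ≥⇒<ᵇ≡false (<⇒≤ lo<v) | <⇒<ᵇ≡true lo<v
        | <⇒<ᵇ≡true v<hi | ≥⇒<ᵇ≡false (<⇒≤ v<hi) = # 2 , refl
...   | tri≈ _ refl _ rewrite ≥⇒<ᵇ≡false (<⇒≤ lo<v) | <⇒<ᵇ≡true lo<v
        | n<ᵇn≡false v = # 3 , refl
...   | tri> _ _ hi<v rewrite ≥⇒<ᵇ≡false (<⇒≤ lo<v) | <⇒<ᵇ≡true lo<v
        | ≥⇒<ᵇ≡false (<⇒≤ hi<v) | <⇒<ᵇ≡true hi<v = # 4 , refl

OrderTypesChecked : (Comparisons → Comparisons → Bool) → Set
OrderTypesChecked Q = ∀ s t → T (Q (compare₂ 1 3 (toℕ {5} s)) (compare₂ 1 3 (toℕ {5} t)))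

checkOrderTypes : ∀ Q → Dec (OrderTypesChecked Q)
checkOrderTypes Q = Fin.all? (λ s → Fin.all? (λ t → T? _))

transfer : ∀ Q → OrderTypesChecked Q → ∀ {lo hi} → lo < hi → ∀ a b → T (Q (compare₂ lo hi a) (compare₂ lo hi b))
transfer Q checked lo<hi a b with compare₂-collapse lo<hi a | compare₂-collapse lo<hi b
... | s , a≈s | t , b≈t = subst₂ (λ u v → T (Q u v)) (sym a≈s) (sym b≈t) (checked s t)

LocalStatement : Set
LocalStatement = (g a<x x<a a<p p<a b<x x<b p<x x<p M<b b<M : Bool) → Bool

admissible : (g a<x x<a a<p p<a b<x x<b b<p p<b : Bool) → Bool
admissible g a<x x<a a<p p<a b<x x<b b<p p<b =
  ((a<x ∨ x<a) ∧ (a<p ∨ p<a)) ∧ ((b<x ∨ x<b) ∧ (g ∨ not (b<p ∨ p<b)))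

-- The last four arguments of φ are p<x, x<p, M<b and b<M, whose values are forced by x < p (resp. p < x) and b < M.
query-x<p query-p<x : Bool → LocalStatement → Comparisons → Comparisons → Bool
query-x<p g φ (a<x , x<a , a<p , p<a) (b<x , x<b , b<p , p<b) =
  if admissible g a<x x<a a<p p<a b<x x<b b<p p<b then φ g a<x x<a a<p p<a b<x x<b false true false true else true
query-p<x g φ (a<p , p<a , a<x , x<a) (b<p , p<b , b<x , x<b) =
  if admissible g a<x x<a a<p p<a b<x x<b b<p p<b then φ g a<x x<a a<p p<a b<x x<b true false false true else true

decideForBoth : {P : Bool → Set} (P? : ∀ g → Dec (P g)) → {True (P? true)} → {True (P? false)} → ∀ g → P g
decideForBoth P? {holds-true} {_} true = toWitness holds-true
decideForBoth P? {_} {holds-false} false = toWitness holds-false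

inversions-x<p-checked : ∀ g → OrderTypesChecked (query-x<p g LocalCounts.inversions-x<p)
inversions-x<p-checked = decideForBoth (λ g → checkOrderTypes (query-x<p g LocalCounts.inversions-x<p))

inversions-p<x-checked : ∀ g → OrderTypesChecked (query-p<x g LocalCounts.inversions-p<x)
inversions-p<x-checked = decideForBoth (λ g → checkOrderTypes (query-p<x g LocalCounts.inversions-p<x))

displacement-x<p-checked : ∀ g → OrderTypesChecked (query-x<p g LocalCounts.displacement-x<p)
displacement-x<p-checked = decideForBoth (λ g → checkOrderTypes (query-x<p g LocalCounts.displacement-x<p))

displacement-p<x-checked : ∀ g → OrderTypesChecked (query-p<x g LocalCounts.displacement-p<x)
displacement-p<x-checked = decideForBoth (λ g → checkOrderTypes (query-p<x g LocalCounts.displacement-p<x))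

≢⇒<ᵇ∨>ᵇ : ∀ {u v} → u ≢ v → T ((u <ᵇ v) ∨ (v <ᵇ u))
≢⇒<ᵇ∨>ᵇ {u} {v} u≢v with <-cmp u v
... | tri< u<v _ _ rewrite <⇒<ᵇ≡true u<v = tt
... | tri≈ _ u≡v _ = contradiction u≡v u≢v
... | tri> _ _ v<u rewrite <⇒<ᵇ≡true v<u | ≥⇒<ᵇ≡false (<⇒≤ v<u) = tt

unless⇒T : ∀ g {u v} → (g ≡ false → u ≡ v) → T (g ∨ not ((u <ᵇ v) ∨ (v <ᵇ u)))
unless⇒T true _ = tt
unless⇒T false {u} {v} u≡v rewrite u≡v refl | n<ᵇn≡false v = tt

T-if : ∀ {c d} → T (if c then d else true) → T c → T d
T-if {true} d _ = d

module LocalIdentities (a b p x M : ℕ) (g : Bool) (a≢x : a ≢ x) (a≢p : a ≢ p) (b≢x : b ≢ x)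
                       (b<M : b < M) (b≡p-unless-g : g ≡ false → b ≡ p) where

  open LocalCounts g (a <ᵇ x) (x <ᵇ a) (a <ᵇ p) (p <ᵇ a) (b <ᵇ x) (x <ᵇ b) (p <ᵇ x) (x <ᵇ p) (M <ᵇ b) (b <ᵇ M) public

  private
    is-admissible : T (admissible g (a <ᵇ x) (x <ᵇ a) (a <ᵇ p) (p <ᵇ a) (b <ᵇ x) (x <ᵇ b) (b <ᵇ p) (p <ᵇ b))
    is-admissible = from T-∧ ( from T-∧ (≢⇒<ᵇ∨>ᵇ a≢x , ≢⇒<ᵇ∨>ᵇ a≢p)
                             , from T-∧ (≢⇒<ᵇ∨>ᵇ b≢x , unless⇒T g b≡p-unless-g))
      where open Equivalence

    Holds : LocalStatement → Set
    Holds φ = T (φ g (a <ᵇ x) (x <ᵇ a) (a <ᵇ p) (p <ᵇ a) (b <ᵇ x) (x <ᵇ b) (p <ᵇ x) (x <ᵇ p) (M <ᵇ b) (b <ᵇ M))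

    holds-x<p : ∀ φ → (∀ g → OrderTypesChecked (query-x<p g φ)) → x < p → Holds φ
    holds-x<p φ checked x<p
      rewrite ≥⇒<ᵇ≡false (<⇒≤ x<p) | <⇒<ᵇ≡true x<p | ≥⇒<ᵇ≡false (<⇒≤ b<M) | <⇒<ᵇ≡true b<M =
      T-if (transfer (query-x<p g φ) (checked g) x<p a b) is-admissible

    holds-p<x : ∀ φ → (∀ g → OrderTypesChecked (query-p<x g φ)) → p < x → Holds φ
    holds-p<x φ checked p<x
      rewrite ≥⇒<ᵇ≡false (<⇒≤ p<x) | <⇒<ᵇ≡true p<x | ≥⇒<ᵇ≡false (<⇒≤ b<M) | <⇒<ᵇ≡true b<M =
      T-if (transfer (query-p<x g φ) (checked g) p<x a b) is-admissible

  inversions-step-x<p : x < p → invertedPX + invertedXM + entersBelowX ≡ invertedPM + 2 * new-three + leavesBelowX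
  inversions-step-x<p x<p = ≡ᵇ⇒≡ _ _ (holds-x<p LocalCounts.inversions-x<p inversions-x<p-checked x<p)

  inversions-step-p<x : p < x → invertedPX + invertedXM + entersAboveX ≡ invertedPM + 2 * new-three + leavesAboveX
  inversions-step-p<x p<x = ≡ᵇ⇒≡ _ _ (holds-p<x LocalCounts.inversions-p<x inversions-p<x-checked p<x)

  displacement-step-x<p : x < p → entersAboveX + entersBelowX + new2-31 ≡ new-five + leavesBelowX
  displacement-step-x<p x<p = ≡ᵇ⇒≡ _ _ (holds-x<p LocalCounts.displacement-x<p displacement-x<p-checked x<p)

  displacement-step-p<x : p < x → entersAboveX ≡ new-five
  displacement-step-p<x p<x = ≡ᵇ⇒≡ _ _ (holds-p<x LocalCounts.displacement-p<x displacement-p<x-checked p<x)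

-- Whether positions i < j of a word τ, with a = τ i, a′ = τ (i + 1), b = τ j, b′ = τ (j + 1), form an
-- occurrence of a vincular pattern.
Shape : Set
Shape = (i j a a′ b b′ : ℕ) → Bool

shape2-31 shape14-23 shape41-32 shape24-13 shape31-42 : Shape
shape2-31 i j a a′ b b′ = (b′ <ᵇ a) ∧ (a <ᵇ b)
shape14-23 i j a a′ b b′ = (suc i <ᵇ j) ∧ ((a <ᵇ b) ∧ ((b <ᵇ b′) ∧ (b′ <ᵇ a′)))
shape41-32 i j a a′ b b′ = (suc i <ᵇ j) ∧ ((a′ <ᵇ b′) ∧ ((b′ <ᵇ b) ∧ (b <ᵇ a)))
shape24-13 i j a a′ b b′ = (suc i <ᵇ j) ∧ ((b <ᵇ a) ∧ ((a <ᵇ b′) ∧ (b′ <ᵇ a′)))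
shape31-42 i j a a′ b b′ = (suc i <ᵇ j) ∧ ((a′ <ᵇ b′) ∧ ((b′ <ᵇ a) ∧ (a <ᵇ b)))

-- The prefix f 0, …, f (L - 1) of f is read as the cycle (f 0 f 1 … f (L - 1)), whose image of f k is next L k.
-- Its values need not be 0, …, L - 1, so the displacement of f k ↦ next L k is the number of letters of the
-- prefix in [f k, next L k) rather than a difference.
module Word (f : ℕ → ℕ) where

  next : ℕ → ℕ → ℕ
  next L k = if suc k <ᵇ L then f (suc k) else f 0

  inversionAt : ℕ → ℕ → ℕ → ℕ
  inversionAt L k l = 𝟙 ((f k <ᵇ f l) ∧ (next L l <ᵇ next L k))

  inversionsAmong : ℕ → ℕ → ℕ
  inversionsAmong L n = ∑[ k < n ] ∑< n (inversionAt L k)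

  inversions : ℕ → ℕ
  inversions L = inversionsAmong L L

  countIn : ℕ → ℕ → ℕ → ℕ
  countIn L u v = ∑[ i < L ] 𝟙 (inInterval u v (f i))

  displacement : ℕ → ℕ
  displacement L = ∑[ k < L ] countIn L (f k) (next L k)

  occurrences : Shape → ℕ → ℕ
  occurrences s L = ∑[ j < L ∸ 1 ] ∑[ i < j ] 𝟙 (s i j (f i) (f (suc i)) (f j) (f (suc j)))

  threePatterns fivePatterns : ℕ → ℕ
  threePatterns L = occurrences shape2-31 L + occurrences shape14-23 L + occurrences shape41-32 L
  fivePatterns L = threePatterns L + occurrences shape24-13 L + occurrences shape31-42 L

  next-inner : ∀ {L k} → suc k < L → next L k ≡ f (suc k)
  next-inner sk<L rewrite <⇒<ᵇ≡true sk<L = refl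

  next-last : ∀ k → next (suc k) k ≡ f 0
  next-last k rewrite n<ᵇn≡false k = refl

  inversionsAmong-suc : ∀ L n → inversionsAmong L (suc n)
                        ≡ inversionsAmong L n + ∑[ k < n ] (inversionAt L k n + inversionAt L n k)
  inversionsAmong-suc L n = trans (∑∑-suc n (inversionAt L)) (trans (cong (rest +_) diagonal) (+-identityʳ rest))
    where
    rest = inversionsAmong L n + ∑[ k < n ] (inversionAt L k n + inversionAt L n k)
    diagonal : inversionAt L n n ≡ 0
    diagonal rewrite n<ᵇn≡false (f n) = refl

  countIn-split : ∀ L {u w v} → u ≤ w → w ≤ v → countIn L u w + countIn L w v ≡ countIn L u v
  countIn-split L u≤w w≤v = trans (sym (∑-distrib-+ L _ _)) (∑-cong L (λ i _ → inInterval-split (f i) u≤w w≤v))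

  countIn-empty : ∀ L {u v} → v ≤ u → countIn L u v ≡ 0
  countIn-empty L v≤u = ∑-zero L _ (λ i _ → inInterval-empty (f i) v≤u)

  pairAt : ℕ → ℕ → ℕ → ℕ
  pairAt L k l = inversionAt L k l + inversionAt L l k

  pairAt-via : ∀ L {k l u v} → next L k ≡ u → next L l ≡ v →
               pairAt L k l ≡ 𝟙 ((f k <ᵇ f l) ∧ (v <ᵇ u)) + 𝟙 ((f l <ᵇ f k) ∧ (u <ᵇ v))
  pairAt-via L refl refl = refl

  module Growth (N : ℕ) (injective : ∀ {i j} → i < N → j < N → f i ≡ f j → i ≡ j)
                (first-max : ∀ {i} → i < N → f i ≤ f 0) where

    distinct : ∀ {i j} → i < N → j < N → i ≢ j → f i ≢ f j
    distinct i<N j<N i≢j fi≡fj = i≢j (injective i<N j<N fi≡fj)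

    below-first : ∀ {i} → i < N → 0 < i → f i < f 0
    below-first {i} i<N 0<i = ≤∧≢⇒< (first-max i<N) (distinct i<N (<-trans 0<i i<N) (≢-sym (<⇒≢ 0<i)))

    module Step (m : ℕ) (m+2≤N : suc (suc m) ≤ N) where

      p x M : ℕ
      p = f m
      x = f (suc m)
      M = f 0

      m+1<N : suc m < N
      m+1<N = m+2≤N

      m<N : m < N
      m<N = <-trans (n<1+n m) m+1<N

      x<M : x < M
      x<M = below-first m+1<N z<s

      p≤M : p ≤ M
      p≤M = first-max m<N

      x≢p : x ≢ p
      x≢p = distinct m+1<N m<N (≢-sym (<⇒≢ (n<1+n m)))

      module Counts (k : ℕ) = LocalCounts (suc k <ᵇ m) (f k <ᵇ x) (x <ᵇ f k) (f k <ᵇ p) (p <ᵇ f k)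
        (f (suc k) <ᵇ x) (x <ᵇ f (suc k)) (p <ᵇ x) (x <ᵇ p) (M <ᵇ f (suc k)) (f (suc k) <ᵇ M)

      inner<N : ∀ {k} → k < m → k < N
      inner<N k<m = <-trans k<m m<N

      inner+1<N : ∀ {k} → k < m → suc k < N
      inner+1<N k<m = <-trans (s≤s k<m) m+1<N

      successor-is-p : ∀ {k} → k < m → (suc k <ᵇ m) ≡ false → f (suc k) ≡ p
      successor-is-p k<m k+1≮m = cong f (≤-antisym k<m (≮⇒≥ λ k+1<m → subst T k+1≮m (<⇒<ᵇ k+1<m)))

      inner≢x : ∀ {k} → k < m → f k ≢ x
      inner≢x k<m = distinct (inner<N k<m) m+1<N (<⇒≢ (m<n⇒m<1+n k<m))

      inner≢p : ∀ {k} → k < m → f k ≢ p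
      inner≢p k<m = distinct (inner<N k<m) m<N (<⇒≢ k<m)

      successor≢x : ∀ {k} → k < m → f (suc k) ≢ x
      successor≢x k<m = distinct (inner+1<N k<m) m+1<N (λ k+1≡m+1 → <⇒≢ k<m (suc-injective k+1≡m+1))

      module Identities {k} (k<m : k < m) = LocalIdentities (f k) (f (suc k)) p x M (suc k <ᵇ m)
        (inner≢x k<m) (inner≢p k<m) (successor≢x k<m) (below-first (inner+1<N k<m) z<s) (successor-is-p k<m)

      L₁ L₂ : ℕ
      L₁ = suc m
      L₂ = suc (suc m)

      increment3 increment5 : ℕ
      increment3 = ∑< m Counts.new2-31 + ∑< m Counts.new14-23 + ∑< m Counts.new41-32
      increment5 = increment3 + ∑< m Counts.new24-13 + ∑< m Counts.new31-42

      ∑new-three : ∑< m Counts.new-three ≡ increment3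
      ∑new-three = ∑-distrib-+₃ m Counts.new2-31 Counts.new14-23 Counts.new41-32

      ∑new-five : ∑< m Counts.new-five ≡ increment5
      ∑new-five = trans (∑-distrib-+₃ m Counts.new-three Counts.new24-13 Counts.new31-42)
                        (cong (λ t → t + ∑< m Counts.new24-13 + ∑< m Counts.new31-42) ∑new-three)

      threePatterns-step : threePatterns L₂ ≡ threePatterns L₁ + increment3
      threePatterns-step =
        interchange (occurrences shape2-31 L₁) (occurrences shape14-23 L₁) (occurrences shape41-32 L₁)
                    (∑< m Counts.new2-31) (∑< m Counts.new14-23) (∑< m Counts.new41-32)
        where
        interchange : ∀ a b c a′ b′ c′ → (a + a′) + (b + b′) + (c + c′) ≡ (a + b + c) + (a′ + b′ + c′)
        interchange = solve-∀

      fivePatterns-step : fivePatterns L₂ ≡ fivePatterns L₁ + increment5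
      fivePatterns-step =
        trans (cong (λ t → t + occurrences shape24-13 L₂ + occurrences shape31-42 L₂) threePatterns-step)
              (interchange (threePatterns L₁) increment3 (occurrences shape24-13 L₁) (occurrences shape31-42 L₁)
                           (∑< m Counts.new24-13) (∑< m Counts.new31-42))
        where
        interchange : ∀ t i d e d′ e′ → (t + i) + (d + d′) + (e + e′) ≡ (t + d + e) + (i + d′ + e′)
        interchange = solve-∀

      crossings : ∀ (q : ℕ → Bool) {b₀ bₘ} → q 0 ≡ b₀ → q m ≡ bₘ →
        ∑[ k < m ] 𝟙 (q k ∧ not (q (suc k))) + 𝟙 bₘ ≡ ∑[ k < m ] 𝟙 (not (q k) ∧ q (suc k)) + 𝟙 b₀
      crossings q refl refl = crossings-balance q m

      crossings-below-x : x < p → ∑< m Counts.leavesBelowX ≡ ∑< m Counts.entersBelowX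
      crossings-below-x x<p =
        trans (sym (+-identityʳ _))
          (trans (crossings (λ k → f k <ᵇ x) (≥⇒<ᵇ≡false (<⇒≤ x<M)) (≥⇒<ᵇ≡false (<⇒≤ x<p))) (+-identityʳ _))

      crossings-above-x : p < x → ∑< m Counts.leavesAboveX ≡ suc (∑< m Counts.entersAboveX)
      crossings-above-x p<x =
        trans (sym (+-identityʳ _))
          (trans (crossings (λ k → x <ᵇ f k) (<⇒<ᵇ≡true x<M) (≥⇒<ᵇ≡false (<⇒≤ p<x))) (+-comm _ 1))

      ∑invertedPX ∑invertedXM ∑invertedPM : ℕ
      ∑invertedPX = ∑< m Counts.invertedPX
      ∑invertedXM = ∑< m Counts.invertedXM
      ∑invertedPM = ∑< m Counts.invertedPM

      summed-inversions : ∀ (enters leaves : ℕ → ℕ) →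
        (∀ {k} → k < m → Counts.invertedPX k + Counts.invertedXM k + enters k
                         ≡ Counts.invertedPM k + 2 * Counts.new-three k + leaves k) →
        ∑invertedPX + ∑invertedXM + ∑< m enters ≡ ∑invertedPM + 2 * increment3 + ∑< m leaves
      summed-inversions enters leaves local = begin
          ∑invertedPX + ∑invertedXM + ∑< m enters
        ≡⟨ ∑-distrib-+₃ m Counts.invertedPX Counts.invertedXM enters ⟨
          ∑[ k < m ] (Counts.invertedPX k + Counts.invertedXM k + enters k)
        ≡⟨ ∑-cong m (λ _ k<m → local k<m) ⟩
          ∑[ k < m ] (Counts.invertedPM k + 2 * Counts.new-three k + leaves k)
        ≡⟨ ∑-distrib-+₃ m Counts.invertedPM (λ k → 2 * Counts.new-three k) leaves ⟩
          ∑invertedPM + ∑[ k < m ] (2 * Counts.new-three k) + ∑< m leaves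
        ≡⟨ cong (λ t → ∑invertedPM + t + ∑< m leaves)
                (trans (∑-distribˡ-* m 2 Counts.new-three) (cong (2 *_) ∑new-three)) ⟩
          ∑invertedPM + 2 * increment3 + ∑< m leaves
        ∎
        where open ≡-Reasoning

      lastPair : pairAt L₂ m (suc m) ≡ 𝟙 ((p <ᵇ x) ∧ (M <ᵇ x)) + 𝟙 ((x <ᵇ p) ∧ (x <ᵇ M))
      lastPair = pairAt-via L₂ (next-inner ≤-refl) (next-last (suc m))

      lastPair-x<p : x < p → pairAt L₂ m (suc m) ≡ 1
      lastPair-x<p x<p rewrite lastPair | ≥⇒<ᵇ≡false (<⇒≤ x<p) | <⇒<ᵇ≡true x<p | <⇒<ᵇ≡true x<M = refl

      lastPair-p<x : p < x → pairAt L₂ m (suc m) ≡ 0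
      lastPair-p<x p<x rewrite lastPair | ≥⇒<ᵇ≡false (<⇒≤ p<x) | <⇒<ᵇ≡true p<x | ≥⇒<ᵇ≡false (<⇒≤ x<M) = refl

      inversions-increment : ∑invertedPX + ∑invertedXM + pairAt L₂ m (suc m) ≡ suc (∑invertedPM + 2 * increment3)
      inversions-increment with <-cmp x p
      ... | tri≈ _ x≡p _ = contradiction x≡p x≢p
      ... | tri< x<p _ _ rewrite lastPair-x<p x<p =
        trans (+-comm _ 1) (cong suc (+-cancelʳ-≡ _ _ _
          (trans (summed-inversions Counts.entersBelowX Counts.leavesBelowX (λ k<m → Identities.inversions-step-x<p k<m x<p))
                 (cong (∑invertedPM + 2 * increment3 +_) (crossings-below-x x<p)))))
      ... | tri> _ _ p<x rewrite lastPair-p<x p<x =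
        trans (+-identityʳ _) (+-cancelʳ-≡ _ _ _
          (trans (summed-inversions Counts.entersAboveX Counts.leavesAboveX (λ k<m → Identities.inversions-step-p<x k<m p<x))
                 (trans (cong (∑invertedPM + 2 * increment3 +_) (crossings-above-x p<x))
                        (+-suc (∑invertedPM + 2 * increment3) (∑< m Counts.entersAboveX)))))

      next₁-inner : ∀ {k} → k < m → next L₁ k ≡ f (suc k)
      next₁-inner k<m = next-inner (s≤s k<m)

      next₂-inner : ∀ {k} → k < m → next L₂ k ≡ f (suc k)
      next₂-inner k<m = next-inner (s≤s (m<n⇒m<1+n k<m))

      inversionsAmong-prefix : inversionsAmong L₂ m ≡ inversionsAmong L₁ m
      inversionsAmong-prefix = ∑-cong m λ k k<m → ∑-cong m λ l l<m →
        cong₂ (λ u v → 𝟙 ((f k <ᵇ f l) ∧ (u <ᵇ v)))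
              (trans (next₂-inner l<m) (sym (next₁-inner l<m))) (trans (next₂-inner k<m) (sym (next₁-inner k<m)))

      inversions₂ : inversions L₂ ≡ (inversionsAmong L₁ m + ∑invertedPX) + (∑invertedXM + pairAt L₂ m (suc m))
      inversions₂ = begin
          inversions L₂
        ≡⟨ inversionsAmong-suc L₂ (suc m) ⟩
          inversionsAmong L₂ (suc m) + ∑[ k < suc m ] pairAt L₂ k (suc m)
        ≡⟨ cong (_+ ∑[ k < suc m ] pairAt L₂ k (suc m)) (inversionsAmong-suc L₂ m) ⟩
          (inversionsAmong L₂ m + ∑[ k < m ] pairAt L₂ k m) + ∑[ k < suc m ] pairAt L₂ k (suc m)
        ≡⟨ cong₂ (λ a b → (a + b) + (∑[ k < m ] pairAt L₂ k (suc m) + pairAt L₂ m (suc m)))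
                 inversionsAmong-prefix (∑-cong m λ _ k<m → pairAt-via L₂ (next₂-inner k<m) (next-inner ≤-refl)) ⟩
          (inversionsAmong L₁ m + ∑invertedPX) + (∑[ k < m ] pairAt L₂ k (suc m) + pairAt L₂ m (suc m))
        ≡⟨ cong (λ c → (inversionsAmong L₁ m + ∑invertedPX) + (c + pairAt L₂ m (suc m)))
                (∑-cong m λ _ k<m → pairAt-via L₂ (next₂-inner k<m) (next-last (suc m))) ⟩
          (inversionsAmong L₁ m + ∑invertedPX) + (∑invertedXM + pairAt L₂ m (suc m))
        ∎
        where open ≡-Reasoning

      inversions₁ : inversions L₁ ≡ inversionsAmong L₁ m + ∑invertedPM
      inversions₁ = trans (inversionsAmong-suc L₁ m)
        (cong (inversionsAmong L₁ m +_) (∑-cong m λ _ k<m → pairAt-via L₁ (next₁-inner k<m) (next-last m)))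

      inversions-step : inversions L₂ ≡ suc (inversions L₁ + 2 * increment3)
      inversions-step = begin
          inversions L₂
        ≡⟨ inversions₂ ⟩
          (inversionsAmong L₁ m + ∑invertedPX) + (∑invertedXM + pairAt L₂ m (suc m))
        ≡⟨ regroup (inversionsAmong L₁ m) ∑invertedPX ∑invertedXM (pairAt L₂ m (suc m)) ⟩
          inversionsAmong L₁ m + (∑invertedPX + ∑invertedXM + pairAt L₂ m (suc m))
        ≡⟨ cong (inversionsAmong L₁ m +_) inversions-increment ⟩
          inversionsAmong L₁ m + suc (∑invertedPM + 2 * increment3)
        ≡⟨ regroup′ (inversionsAmong L₁ m) ∑invertedPM (2 * increment3) ⟩
          suc (inversionsAmong L₁ m + ∑invertedPM + 2 * increment3)
        ≡⟨ cong (λ i → suc (i + 2 * increment3)) inversions₁ ⟨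
          suc (inversions L₁ + 2 * increment3)
        ∎
        where
        open ≡-Reasoning
        regroup : ∀ a b c d → (a + b) + (c + d) ≡ a + (b + c + d)
        regroup = solve-∀
        regroup′ : ∀ a b c → a + suc (b + c) ≡ suc (a + b + c)
        regroup′ = solve-∀

      ∑countIn : ℕ
      ∑countIn = ∑[ k < m ] countIn L₁ (f k) (f (suc k))

      displacement₂ : displacement L₂ ≡ (∑countIn + ∑< m Counts.entersAboveX) + (countIn L₁ p x + 0) + (countIn L₁ x M + 1)
      displacement₂ =
        cong₂ _+_ (cong₂ _+_ inner (trans (cong (countIn L₂ p) (next-inner ≤-refl)) (cong (countIn L₁ p x +_) x∉[p,x⟩)))
                  (trans (cong (countIn L₂ x) (next-last (suc m))) (cong (countIn L₁ x M +_) x∈[x,M⟩))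
        where
        inner : ∑[ k < m ] countIn L₂ (f k) (next L₂ k) ≡ ∑countIn + ∑< m Counts.entersAboveX
        inner = trans (∑-cong m λ k k<m → cong (countIn L₂ (f k)) (next₂-inner k<m)) (∑-distrib-+ m _ Counts.entersAboveX)
        x∉[p,x⟩ : 𝟙 (inInterval p x x) ≡ 0
        x∉[p,x⟩ rewrite n<ᵇn≡false x = 𝟙[b∧false]≡0 (not (x <ᵇ p))
        x∈[x,M⟩ : 𝟙 (inInterval x M x) ≡ 1
        x∈[x,M⟩ rewrite n<ᵇn≡false x | <⇒<ᵇ≡true x<M = refl

      displacement₁ : displacement L₁ ≡ ∑countIn + countIn L₁ p M
      displacement₁ = cong₂ _+_ (∑-cong m λ k k<m → cong (countIn L₁ (f k)) (next₁-inner k<m))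
                                (cong (countIn L₁ p) (next-last m))

      countIn-x-p : countIn L₁ x p ≡ ∑< m Counts.new2-31
      countIn-x-p = trans
        (cong₂ _+_ (∑-cong m λ k k<m → cong (λ b → 𝟙 (b ∧ (f k <ᵇ p))) (not[<ᵇ]≡>ᵇ (inner≢x k<m))) p∉[x,p⟩)
        (+-identityʳ _)
        where
        p∉[x,p⟩ : 𝟙 (inInterval x p p) ≡ 0
        p∉[x,p⟩ rewrite n<ᵇn≡false p = 𝟙[b∧false]≡0 (not (p <ᵇ x))

      ∑entersAboveX-p<x : p < x → ∑< m Counts.entersAboveX ≡ increment5
      ∑entersAboveX-p<x p<x = trans (∑-cong m (λ _ k<m → Identities.displacement-step-p<x k<m p<x)) ∑new-five

      ∑entersAboveX-x<p : x < p → ∑< m Counts.entersAboveX + ∑< m Counts.new2-31 ≡ increment5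
      ∑entersAboveX-x<p x<p = +-cancelʳ-≡ _ _ _ (begin
          ∑< m Counts.entersAboveX + ∑< m Counts.new2-31 + ∑< m Counts.entersBelowX
        ≡⟨ swap (∑< m Counts.entersAboveX) (∑< m Counts.new2-31) (∑< m Counts.entersBelowX) ⟩
          ∑< m Counts.entersAboveX + ∑< m Counts.entersBelowX + ∑< m Counts.new2-31
        ≡⟨ ∑-distrib-+₃ m Counts.entersAboveX Counts.entersBelowX Counts.new2-31 ⟨
          ∑[ k < m ] (Counts.entersAboveX k + Counts.entersBelowX k + Counts.new2-31 k)
        ≡⟨ ∑-cong m (λ _ k<m → Identities.displacement-step-x<p k<m x<p) ⟩
          ∑[ k < m ] (Counts.new-five k + Counts.leavesBelowX k)
        ≡⟨ ∑-distrib-+ m Counts.new-five Counts.leavesBelowX ⟩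
          ∑< m Counts.new-five + ∑< m Counts.leavesBelowX
        ≡⟨ cong₂ _+_ ∑new-five (crossings-below-x x<p) ⟩
          increment5 + ∑< m Counts.entersBelowX
        ∎)
        where
        open ≡-Reasoning
        swap : ∀ a b c → a + b + c ≡ a + c + b
        swap = solve-∀

      displacement-increment : ∑< m Counts.entersAboveX + (countIn L₁ p x + countIn L₁ x M) ≡ countIn L₁ p M + increment5
      displacement-increment with <-cmp x p
      ... | tri≈ _ x≡p _ = contradiction x≡p x≢p
      ... | tri> _ _ p<x = trans (cong₂ _+_ (∑entersAboveX-p<x p<x) (countIn-split L₁ (<⇒≤ p<x) (<⇒≤ x<M)))
                                 (+-comm increment5 (countIn L₁ p M))
      ... | tri< x<p _ _ = begin
          ∑< m Counts.entersAboveX + (countIn L₁ p x + countIn L₁ x M)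
        ≡⟨ cong₂ (λ a b → ∑< m Counts.entersAboveX + (a + b))
                 (countIn-empty L₁ (<⇒≤ x<p)) (sym (countIn-split L₁ (<⇒≤ x<p) p≤M)) ⟩
          ∑< m Counts.entersAboveX + (0 + (countIn L₁ x p + countIn L₁ p M))
        ≡⟨ cong (λ c → ∑< m Counts.entersAboveX + (c + countIn L₁ p M)) countIn-x-p ⟩
          ∑< m Counts.entersAboveX + (∑< m Counts.new2-31 + countIn L₁ p M)
        ≡⟨ regroup (∑< m Counts.entersAboveX) (∑< m Counts.new2-31) (countIn L₁ p M) ⟩
          countIn L₁ p M + (∑< m Counts.entersAboveX + ∑< m Counts.new2-31)
        ≡⟨ cong (countIn L₁ p M +_) (∑entersAboveX-x<p x<p) ⟩
          countIn L₁ p M + increment5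
        ∎
        where
        open ≡-Reasoning
        regroup : ∀ a b c → a + (0 + (b + c)) ≡ c + (a + b)
        regroup = solve-∀

      displacement-step : displacement L₂ ≡ suc (displacement L₁ + increment5)
      displacement-step = begin
          displacement L₂
        ≡⟨ displacement₂ ⟩
          (∑countIn + ∑< m Counts.entersAboveX) + (countIn L₁ p x + 0) + (countIn L₁ x M + 1)
        ≡⟨ regroup ∑countIn (∑< m Counts.entersAboveX) (countIn L₁ p x) (countIn L₁ x M) ⟩
          suc (∑countIn + (∑< m Counts.entersAboveX + (countIn L₁ p x + countIn L₁ x M)))
        ≡⟨ cong (λ t → suc (∑countIn + t)) displacement-increment ⟩
          suc (∑countIn + (countIn L₁ p M + increment5))
        ≡⟨ cong suc (sym (+-assoc ∑countIn (countIn L₁ p M) increment5)) ⟩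
          suc (∑countIn + countIn L₁ p M + increment5)
        ≡⟨ cong (λ d → suc (d + increment5)) displacement₁ ⟨
          suc (displacement L₁ + increment5)
        ∎
        where
        open ≡-Reasoning
        regroup : ∀ a b c d → (a + b) + (c + 0) + (d + 1) ≡ suc (a + (b + (c + d)))
        regroup = solve-∀

    statistics : ∀ m → suc m ≤ N →
      inversions (suc m) ≡ m + 2 * threePatterns (suc m) × displacement (suc m) ≡ m + fivePatterns (suc m)
    statistics zero _ = single-inversions , single-displacement
      where
      single-inversions : inversions 1 ≡ 0
      single-inversions rewrite n<ᵇn≡false (f 0) = refl
      single-displacement : displacement 1 ≡ 0
      single-displacement rewrite n<ᵇn≡false (f 0) = refl
    statistics (suc m) m+2≤N with statistics m (<⇒≤ m+2≤N)
    ... | inversions₁ , displacement₁ = inversions-closed , displacement-closed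
      where
      open Step m m+2≤N using (L₁; L₂; increment3; increment5; inversions-step; displacement-step;
                               threePatterns-step; fivePatterns-step)
      open ≡-Reasoning

      inversions-closed : inversions L₂ ≡ suc m + 2 * threePatterns L₂
      inversions-closed = begin
          inversions L₂
        ≡⟨ inversions-step ⟩
          suc (inversions L₁ + 2 * increment3)
        ≡⟨ cong (λ i → suc (i + 2 * increment3)) inversions₁ ⟩
          suc (m + 2 * threePatterns L₁ + 2 * increment3)
        ≡⟨ cong suc (+-assoc m _ _) ⟩
          suc (m + (2 * threePatterns L₁ + 2 * increment3))
        ≡⟨ cong (λ t → suc (m + t)) (sym (*-distribˡ-+ 2 (threePatterns L₁) increment3)) ⟩
          suc m + 2 * (threePatterns L₁ + increment3)
        ≡⟨ cong (λ t → suc m + 2 * t) threePatterns-step ⟨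
          suc m + 2 * threePatterns L₂
        ∎

      displacement-closed : displacement L₂ ≡ suc m + fivePatterns L₂
      displacement-closed = begin
          displacement L₂
        ≡⟨ displacement-step ⟩
          suc (displacement L₁ + increment5)
        ≡⟨ cong (λ d → suc (d + increment5)) displacement₁ ⟩
          suc (m + fivePatterns L₁ + increment5)
        ≡⟨ cong suc (+-assoc m _ _) ⟩
          suc m + (fivePatterns L₁ + increment5)
        ≡⟨ cong (suc m +_) fivePatterns-step ⟨
          suc m + fivePatterns L₂
        ∎

argmax : ∀ (h : ℕ → ℕ) d → ∃[ r ] r ≤ d × (∀ {s} → s ≤ d → h s ≤ h r)
argmax h zero = 0 , z≤n , λ { z≤n → ≤-refl }
argmax h (suc d) with argmax h d
... | r , r≤d , maximal with h (suc d) ≤? h r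
...   | yes last≤ = r , m≤n⇒m≤1+n r≤d , λ s≤1+d → case m≤n⇒m<n∨m≡n s≤1+d of λ where
          (inj₁ s<1+d) → maximal (≤-pred s<1+d)
          (inj₂ refl) → last≤
...   | no last≰ = suc d , ≤-refl , λ s≤1+d → case m≤n⇒m<n∨m≡n s≤1+d of λ where
          (inj₁ s<1+d) → ≤-trans (maximal (≤-pred s<1+d)) (<⇒≤ (≰⇒> last≰))
          (inj₂ refl) → ≤-refl

countᵇ-tabulate-≥1 : ∀ {A : Set} {m} (p : A → Bool) (g : Fin m → A) a → p (g a) ≡ true → 1 ≤ countᵇ p (tabulate g)
countᵇ-tabulate-≥1 p g zero pa rewrite pa = s≤s z≤n
countᵇ-tabulate-≥1 p g (suc a) pa =
  ≤-trans (countᵇ-tabulate-≥1 p (λ i → g (suc i)) a pa) (m≤n+m _ (if p (g zero) then 1 else 0))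

countᵇ-tabulate-≥2 : ∀ {A : Set} {m} (p : A → Bool) (g : Fin m → A) {a b} → a ≢ b →
                     p (g a) ≡ true → p (g b) ≡ true → 2 ≤ countᵇ p (tabulate g)
countᵇ-tabulate-≥2 p g {zero} {zero} a≢b _ _ = contradiction refl a≢b
countᵇ-tabulate-≥2 p g {zero} {suc b} _ pa pb rewrite pa = s≤s (countᵇ-tabulate-≥1 p (λ i → g (suc i)) b pb)
countᵇ-tabulate-≥2 p g {suc a} {zero} _ pa pb rewrite pb = s≤s (countᵇ-tabulate-≥1 p (λ i → g (suc i)) a pa)
countᵇ-tabulate-≥2 p g {suc a} {suc b} a≢b pa pb =
  ≤-trans (countᵇ-tabulate-≥2 p (λ i → g (suc i)) (λ a≡b → a≢b (cong suc a≡b)) pa pb)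
          (m≤n+m _ (if p (g zero) then 1 else 0))

all-applyUpTo : ∀ {A : Set} (p : A → Bool) (g : ℕ → A) m → (∀ {k} → k < m → p (g k) ≡ true) →
                all p (applyUpTo g m) ≡ true
all-applyUpTo p g zero _ = refl
all-applyUpTo p g (suc m) holds rewrite holds z<s = all-applyUpTo p (λ k → g (suc k)) m (λ k<m → holds (s<s k<m))

module Orbits {n} (σ : Permutation′ n) where

  iter-+ : ∀ a b y → iter σ (a + b) y ≡ iter σ a (iter σ b y)
  iter-+ zero b y = refl
  iter-+ (suc a) b y = cong (σ ⟨$⟩ʳ_) (iter-+ a b y)

  iter-injective : ∀ a {u v} → iter σ a u ≡ iter σ a v → u ≡ v
  iter-injective zero eq = eq
  iter-injective (suc a) {u} {v} eq =
    iter-injective a (trans (sym (inverseˡ σ)) (trans (cong (σ ⟨$⟩ˡ_) eq) (inverseˡ σ)))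

  repeat⇒period : ∀ {k l} y → k < l → iter σ k y ≡ iter σ l y → iter σ (l ∸ k) y ≡ y
  repeat⇒period {k} {l} y k<l eq = sym (iter-injective k
    (trans eq (trans (cong (λ e → iter σ e y) (sym (m+[n∸m]≡n (<⇒≤ k<l)))) (iter-+ k (l ∸ k) y))))

  period : ∀ y → ∃[ d ] 0 < d × d ≤ n × iter σ d y ≡ y
  period y with Fin.pigeonhole (n<1+n n) (λ (k : Fin (suc n)) → iter σ (toℕ k) y)
  ... | i , j , i<j , eq =
    toℕ j ∸ toℕ i , m<n⇒0<n∸m i<j , ≤-trans (m∸n≤m (toℕ j) (toℕ i)) (Fin.toℕ≤pred[n] j) , repeat⇒period y i<j eq

  reduce : ∀ {d y} → 0 < d → iter σ d y ≡ y → ∀ e → ∃[ r ] r < d × iter σ e y ≡ iter σ r y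
  reduce 0<d _ zero = 0 , 0<d , refl
  reduce {d} {y} 0<d period-d (suc e) with reduce 0<d period-d e
  ... | r , r<d , eq with suc r <? d
  ...   | yes r+1<d = suc r , r+1<d , cong (σ ⟨$⟩ʳ_) eq
  ...   | no r+1≮d = 0 , 0<d , trans (cong (σ ⟨$⟩ʳ_) eq)
                               (trans (cong (λ e → iter σ e y) (≤-antisym r<d (≮⇒≥ r+1≮d))) period-d)

≤⇒≤ᵇ≡true : ∀ {m n} → m ≤ n → (m ≤ᵇ n) ≡ true
≤⇒≤ᵇ≡true z≤n = refl
≤⇒≤ᵇ≡true (s≤s m≤n) = <⇒<ᵇ≡true (s≤s m≤n)

module SingleCycle {n} (σ : Permutation′ (suc n)) (cycle : IsCycle σ) where
  open Orbits σ

  top : Fin (suc n)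
  top = fromℕ n

  orbit : ℕ → Fin (suc n)
  orbit k = iter σ k top

  toℕ≤top : ∀ (i : Fin (suc n)) → toℕ i ≤ toℕ top
  toℕ≤top i = subst (toℕ i ≤_) (sym (Fin.toℕ-fromℕ n)) (Fin.toℕ≤pred[n] i)

  cycleMax-unique : ∀ {a b} → isCycleMax σ a ≡ true → isCycleMax σ b ≡ true → a ≡ b
  cycleMax-unique {a} {b} a-max b-max with a Fin.≟ b
  ... | yes a≡b = a≡b
  ... | no a≢b = contradiction (subst (2 ≤_) cycle (countᵇ-tabulate-≥2 (isCycleMax σ) (λ i → i) a≢b a-max b-max))
                               λ { (s≤s ()) }

  isCycleMax-intro : ∀ i → (∀ k → toℕ (iter σ k i) ≤ toℕ i) → isCycleMax σ i ≡ true
  isCycleMax-intro i bounded = all-applyUpTo _ (λ k → k) (suc n) (λ {k} _ → ≤⇒≤ᵇ≡true (bounded k))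

  top-isCycleMax : isCycleMax σ top ≡ true
  top-isCycleMax = isCycleMax-intro top (λ k → toℕ≤top (iter σ k top))

  -- The largest element of the orbit of y is a cycle maximum, hence it is top.
  reaches : ∀ y → ∃[ e ] orbit e ≡ y
  reaches y with period y
  ... | suc d , _ , _ , period-y with argmax (λ k → toℕ (iter σ k y)) d
  ...   | r , r≤d , maximal = suc d ∸ r , (begin
      iter σ (suc d ∸ r) top            ≡⟨ cong (iter σ (suc d ∸ r)) (cycleMax-unique top-isCycleMax maximum-isCycleMax) ⟩
      iter σ (suc d ∸ r) (iter σ r y)   ≡⟨ iter-+ (suc d ∸ r) r y ⟨
      iter σ (suc d ∸ r + r) y          ≡⟨ cong (λ e → iter σ e y) (m∸n+n≡m (m≤n⇒m≤1+n r≤d)) ⟩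
      iter σ (suc d) y                  ≡⟨ period-y ⟩
      y                                 ∎)
    where
    open ≡-Reasoning
    maximum-isCycleMax : isCycleMax σ (iter σ r y) ≡ true
    maximum-isCycleMax = isCycleMax-intro (iter σ r y) λ k → case reduce z<s period-y (k + r) of λ where
      (r′ , r′<1+d , eq) →
        subst (λ z → toℕ z ≤ toℕ (iter σ r y)) (trans (sym eq) (iter-+ k r y)) (maximal (≤-pred r′<1+d))

  orbit-surjective-within : ∀ {d} → 0 < d → iter σ d top ≡ top → ∀ y → ∃[ r ] orbit (toℕ {d} r) ≡ y
  orbit-surjective-within 0<d period-d y =
    let e , orbit-e≡y = reaches y
        r , r<d , eq = reduce 0<d period-d e
    in fromℕ< r<d , trans (cong orbit (Fin.toℕ-fromℕ< r<d)) (trans (sym eq) orbit-e≡y)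

  period-≥ : ∀ {d} → 0 < d → iter σ d top ≡ top → suc n ≤ d
  period-≥ {d} 0<d period-d = Fin.injective⇒≤ residue-injective
    where
    residue : Fin (suc n) → Fin d
    residue y = proj₁ (orbit-surjective-within 0<d period-d y)
    residue-injective : Injective _≡_ _≡_ residue
    residue-injective {i} {j} same =
      trans (sym (proj₂ (orbit-surjective-within 0<d period-d i)))
            (trans (cong (λ r → orbit (toℕ r)) same) (proj₂ (orbit-surjective-within 0<d period-d j)))

  orbit-period : orbit (suc n) ≡ top
  orbit-period with period top
  ... | d , 0<d , d≤n , period-d = subst (λ e → iter σ e top ≡ top) (≤-antisym d≤n (period-≥ 0<d period-d)) period-d

  orbit-surjective : ∀ y → ∃[ k ] k < suc n × orbit k ≡ y
  orbit-surjective y = let r , orbit-r≡y = orbit-surjective-within z<s orbit-period y in toℕ r , Fin.toℕ<n r , orbit-r≡y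

  orbit-injective : ∀ {k l} → k < suc n → l < suc n → orbit k ≡ orbit l → k ≡ l
  orbit-injective {k} {l} k<N l<N eq with <-cmp k l
  ... | tri≈ _ k≡l _ = k≡l
  ... | tri< k<l _ _ = contradiction (period-≥ (m<n⇒0<n∸m k<l) (repeat⇒period top k<l eq))
                                     (<⇒≱ (≤-<-trans (m∸n≤m l k) l<N))
  ... | tri> _ _ l<k = contradiction (period-≥ (m<n⇒0<n∸m l<k) (repeat⇒period top l<k (sym eq)))
                                     (<⇒≱ (≤-<-trans (m∸n≤m k l) k<N))

if-then-1-else-0 : ∀ b → (if b then 1 else 0) ≡ 𝟙 b
if-then-1-else-0 true = refl
if-then-1-else-0 false = refl

sum-applyUpTo : ∀ (g : ℕ → ℕ) m → sum (applyUpTo g m) ≡ ∑< m g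
sum-applyUpTo g zero = refl
sum-applyUpTo g (suc m) = trans (cong (g 0 +_) (sum-applyUpTo (λ k → g (suc k)) m)) (sym (∑-suc m g))

countᵇ-applyUpTo : ∀ {A : Set} (q : A → Bool) (g : ℕ → A) m → countᵇ q (applyUpTo g m) ≡ ∑[ k < m ] 𝟙 (q (g k))
countᵇ-applyUpTo q g zero = refl
countᵇ-applyUpTo q g (suc m) =
  trans (cong₂ _+_ (if-then-1-else-0 (q (g 0))) (countᵇ-applyUpTo q (λ k → g (suc k)) m)) (sym (∑-suc m _))

countᵇ-as-sum : ∀ {A : Set} (q : A → Bool) xs → countᵇ q xs ≡ sum (map (λ x → 𝟙 (q x)) xs)
countᵇ-as-sum q [] = refl
countᵇ-as-sum q (x ∷ xs) = cong₂ _+_ (if-then-1-else-0 (q x)) (countᵇ-as-sum q xs)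

sum-tabulate-toℕ : ∀ m (g : ℕ → ℕ) → sum (tabulate {n = m} (λ i → g (toℕ i))) ≡ ∑< m g
sum-tabulate-toℕ zero g = refl
sum-tabulate-toℕ (suc m) g = trans (cong (g 0 +_) (sum-tabulate-toℕ m (λ k → g (suc k)))) (sym (∑-suc m g))

at-applyUpTo : ∀ (g : ℕ → ℕ) {m k} → k < m → at (applyUpTo g m) k ≡ g k
at-applyUpTo g {suc m} {zero} _ = refl
at-applyUpTo g {suc m} {suc k} k+1<m+1 = at-applyUpTo (λ i → g (suc i)) (s<s⁻¹ k+1<m+1)

∑-below : ∀ n {j} → j ≤ n → (c : ℕ → Bool) → ∑[ i < n ] 𝟙 ((i <ᵇ j) ∧ c i) ≡ ∑[ i < j ] 𝟙 (c i)
∑-below zero z≤n c = refl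
∑-below (suc n) {j} j≤n+1 c with j ≟ suc n
... | yes refl = ∑-cong (suc n) (λ i i<j → cong (λ b → 𝟙 (b ∧ c i)) (<⇒<ᵇ≡true i<j))
... | no j≢n+1 = trans (cong₂ _+_ (∑-below n j≤n c) (cong (λ b → 𝟙 (b ∧ c n)) (≥⇒<ᵇ≡false j≤n))) (+-identityʳ _)
  where j≤n = s≤s⁻¹ (≤∧≢⇒< j≤n+1 j≢n+1)

∑-drop-last : ∀ L (g : ℕ → ℕ) → ∑[ j < L ] (if suc j <ᵇ L then g j else 0) ≡ ∑< (L ∸ 1) g
∑-drop-last zero g = refl
∑-drop-last (suc L) g =
  trans (cong₂ _+_ (∑-cong L (λ j j<L → cong (λ b → if b then g j else 0) (<⇒<ᵇ≡true j<L)))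
                   (cong (λ b → if b then g L else 0) (n<ᵇn≡false L)))
        (+-identityʳ _)

count-below : ∀ n {v} → v ≤ n → ∑[ w < n ] 𝟙 (w <ᵇ v) ≡ v
count-below zero z≤n = refl
count-below (suc n) {v} v≤n+1 with v ≟ suc n
... | yes refl = trans (cong (_+ 𝟙 (n <ᵇ suc n)) (trans (∑-cong n below-both) (count-below n ≤-refl)))
                       (trans (cong (λ b → n + 𝟙 b) (<⇒<ᵇ≡true (n<1+n n))) (+-comm n 1))
  where
  below-both : ∀ w → w < n → 𝟙 (w <ᵇ suc n) ≡ 𝟙 (w <ᵇ n)
  below-both w w<n = cong 𝟙 (trans (<⇒<ᵇ≡true (m<n⇒m<1+n w<n)) (sym (<⇒<ᵇ≡true w<n)))
... | no v≢n+1 = trans (cong₂ _+_ (count-below n v≤n) (cong 𝟙 (≥⇒<ᵇ≡false v≤n))) (+-identityʳ v)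
  where v≤n = s≤s⁻¹ (≤∧≢⇒< v≤n+1 v≢n+1)

count-interval : ∀ n u {v} → v ≤ n → ∑[ w < n ] 𝟙 (inInterval u v w) ≡ v ∸ u
count-interval n u {v} v≤n with u ≤? v
... | no u≰v = trans (∑-zero n _ (λ w _ → inInterval-empty w v≤u)) (sym (m≤n⇒m∸n≡0 v≤u))
  where v≤u = <⇒≤ (≰⇒> u≰v)
... | yes u≤v = trans (sym (m+n∸n≡m _ u)) (cong (_∸ u) (begin
    ∑[ w < n ] 𝟙 (inInterval u v w) + u
  ≡⟨ +-comm _ u ⟩
    u + ∑[ w < n ] 𝟙 (inInterval u v w)
  ≡⟨ cong (_+ ∑[ w < n ] 𝟙 (inInterval u v w)) (count-below n (≤-trans u≤v v≤n)) ⟨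
    ∑[ w < n ] 𝟙 (w <ᵇ u) + ∑[ w < n ] 𝟙 (inInterval u v w)
  ≡⟨ ∑-distrib-+ n _ _ ⟨
    ∑[ w < n ] (𝟙 (inInterval 0 u w) + 𝟙 (inInterval u v w))
  ≡⟨ ∑-cong n (λ w _ → inInterval-split w z≤n u≤v) ⟩
    ∑[ w < n ] 𝟙 (w <ᵇ v)
  ≡⟨ count-below n v≤n ⟩
    v
  ∎))
  where open ≡-Reasoning

countPairs-applyUpTo : ∀ (s : Shape) (t : ℕ → ℕ) L → let τ = applyUpTo t L in
  countPairs (λ i j → s i j (at τ i) (at τ (suc i)) (at τ j) (at τ (suc j))) τ
    ≡ ∑[ j < L ∸ 1 ] ∑[ i < j ] 𝟙 (s i j (t i) (t (suc i)) (t j) (t (suc j)))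
countPairs-applyUpTo s t L = begin
    countPairs occursτ τ
  ≡⟨ cong (λ ℓ → sum (map (λ i → countᵇ (λ j → (i <ᵇ j) ∧ ((suc j <ᵇ ℓ) ∧ occursτ i j)) (upTo ℓ)) (upTo ℓ)))
          (List.length-applyUpTo t L) ⟩
    sum (map (λ i → countᵇ (pair i) (upTo L)) (upTo L))
  ≡⟨ cong sum (List.map-applyUpTo (λ k → k) _ L) ⟩
    sum (applyUpTo (λ i → countᵇ (pair i) (upTo L)) L)
  ≡⟨ sum-applyUpTo _ L ⟩
    ∑[ i < L ] countᵇ (pair i) (upTo L)
  ≡⟨ ∑-cong L (λ i _ → countᵇ-applyUpTo (pair i) (λ k → k) L) ⟩
    ∑[ i < L ] ∑[ j < L ] 𝟙 (pair i j)
  ≡⟨ ∑-comm L L _ ⟩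
    ∑[ j < L ] ∑[ i < L ] 𝟙 (pair i j)
  ≡⟨ ∑-cong L (λ j _ → column j) ⟩
    ∑[ j < L ] (if suc j <ᵇ L then ∑[ i < j ] 𝟙 (occurs i j) else 0)
  ≡⟨ ∑-drop-last L _ ⟩
    ∑[ j < L ∸ 1 ] ∑[ i < j ] 𝟙 (occurs i j)
  ∎
  where
  open ≡-Reasoning
  τ = applyUpTo t L
  occursτ occurs pair : ℕ → ℕ → Bool
  occursτ i j = s i j (at τ i) (at τ (suc i)) (at τ j) (at τ (suc j))
  occurs i j = s i j (t i) (t (suc i)) (t j) (t (suc j))
  pair i j = (i <ᵇ j) ∧ ((suc j <ᵇ L) ∧ occursτ i j)
  column : ∀ j → ∑[ i < L ] 𝟙 (pair i j) ≡ (if suc j <ᵇ L then ∑[ i < j ] 𝟙 (occurs i j) else 0)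
  column j with suc j <ᵇ L in j+1<ᵇL
  ... | false = ∑-zero L _ (λ i _ → 𝟙[b∧false]≡0 (i <ᵇ j))
  ... | true = trans (∑-cong L (λ i _ → inside i)) (∑-below L (<⇒≤ (<-trans (n<1+n j) j+1<L)) (λ i → occurs i j))
    where
    j+1<L : suc j < L
    j+1<L = <ᵇ⇒< (suc j) L (subst T (sym j+1<ᵇL) _)
    inside : ∀ i → 𝟙 ((i <ᵇ j) ∧ (true ∧ occursτ i j)) ≡ 𝟙 ((i <ᵇ j) ∧ occurs i j)
    inside i with i <ᵇ j in i<ᵇj
    ... | false = refl
    ... | true = cong 𝟙 (trans
      (cong₂ (λ a a′ → s i j a a′ (at τ j) (at τ (suc j)))
             (at-applyUpTo t (<-trans i<j j<L)) (at-applyUpTo t (≤-<-trans i<j j<L)))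
      (cong₂ (λ b b′ → s i j (t i) (t (suc i)) b b′) (at-applyUpTo t j<L) (at-applyUpTo t j+1<L)))
      where
      i<j = <ᵇ⇒< i j (subst T (sym i<ᵇj) _)
      j<L = <-trans (n<1+n j) j+1<L

sum-tabulate-cong : ∀ {m} {F G : Fin m → ℕ} → (∀ i → F i ≡ G i) → sum (tabulate F) ≡ sum (tabulate G)
sum-tabulate-cong {zero} _ = refl
sum-tabulate-cong {suc m} F≗G = cong₂ _+_ (F≗G zero) (sum-tabulate-cong (λ i → F≗G (suc i)))

sum-tabulate-comm : ∀ {m} k (H : ℕ → Fin m → ℕ) →
  sum (tabulate (λ i → ∑[ l < k ] H l i)) ≡ ∑[ l < k ] sum (tabulate (H l))
sum-tabulate-comm {zero} k H = sym (∑-zero k _ (λ _ _ → refl))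
sum-tabulate-comm {suc m} k H =
  trans (cong (∑[ l < k ] H l zero +_) (sum-tabulate-comm k (λ l i → H l (suc i))))
        (sym (∑-distrib-+ k (λ l → H l zero) (λ l → sum (tabulate (λ i → H l (suc i))))))

≡ᵇ-refl : ∀ k → (k ≡ᵇ k) ≡ true
≡ᵇ-refl zero = refl
≡ᵇ-refl (suc k) = ≡ᵇ-refl k

eqFin⇒≡ : ∀ {m} {a b : Fin m} → eqFin a b ≡ true → a ≡ b
eqFin⇒≡ {a = a} {b} eq = Fin.toℕ-injective (≡ᵇ⇒≡ (toℕ a) (toℕ b) (subst T (sym eq) _))

sum-tabulate-δ : ∀ {m} (a : Fin m) (F : Fin m → ℕ) → sum (tabulate (λ i → if eqFin a i then F i else 0)) ≡ F a
sum-tabulate-δ {suc m} zero F = trans (cong (F zero +_) (sum-zeros m)) (+-identityʳ _)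
  where
  sum-zeros : ∀ m → sum (tabulate {n = m} (λ _ → 0)) ≡ 0
  sum-zeros zero = refl
  sum-zeros (suc m) = sum-zeros m
sum-tabulate-δ {suc m} (suc a) F = sum-tabulate-δ a (λ i → F (suc i))

sum-tabulate-reindex : ∀ {m} (π : ℕ → Fin m) → (∀ {k l} → k < m → l < m → π k ≡ π l → k ≡ l) →
  (∀ i → ∃[ k ] k < m × π k ≡ i) → ∀ (F : Fin m → ℕ) → sum (tabulate F) ≡ ∑[ k < m ] F (π k)
sum-tabulate-reindex {m} π injective surjective F = begin
    sum (tabulate F)
  ≡⟨ sum-tabulate-cong hit-once ⟨
    sum (tabulate (λ i → ∑[ k < m ] δ k i))
  ≡⟨ sum-tabulate-comm m δ ⟩
    ∑[ k < m ] sum (tabulate (δ k))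
  ≡⟨ ∑-cong m (λ k _ → sum-tabulate-δ (π k) F) ⟩
    ∑[ k < m ] F (π k)
  ∎
  where
  open ≡-Reasoning
  δ : ℕ → Fin m → ℕ
  δ k i = if eqFin (π k) i then F i else 0
  hit-once : ∀ i → ∑[ k < m ] δ k i ≡ F i
  hit-once i with surjective i
  ... | k₀ , k₀<m , πk₀≡i = trans (∑-single m _ k₀ k₀<m missed) (cong (λ b → if b then F i else 0) hit)
    where
    hit : eqFin (π k₀) i ≡ true
    hit = trans (cong (λ j → eqFin j i) πk₀≡i) (≡ᵇ-refl (toℕ i))
    missed : ∀ k → k < m → k ≢ k₀ → δ k i ≡ 0
    missed k k<m k≢k₀ with eqFin (π k) i in πk≟i
    ... | false = refl
    ... | true = contradiction (injective k<m k₀<m (trans (eqFin⇒≡ πk≟i) (sym πk₀≡i))) k≢k₀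

takeWhileᵇ-applyUpTo : ∀ {A : Set} (p : A → Bool) (h : ℕ → A) m {y ys} → (∀ {k} → k < m → p (h k) ≡ true) →
                       p y ≡ false → takeWhileᵇ p (applyUpTo h m ++ y ∷ ys) ≡ applyUpTo h m
takeWhileᵇ-applyUpTo p h zero _ py rewrite py = refl
takeWhileᵇ-applyUpTo p h (suc m) ph py rewrite ph z<s =
  cong (h 0 ∷_) (takeWhileᵇ-applyUpTo p (λ k → h (suc k)) m (λ k<m → ph (s<s k<m)) py)

filter-tabulate-single : ∀ {A : Set} {m} {P : A → Set} (P? : Decidable P) (g : Fin m → A) a →
                         P (g a) → (∀ i → P (g i) → i ≡ a) → filter P? (tabulate g) ≡ g a ∷ []
filter-tabulate-single P? g zero pa unique = trans (List.filter-accept P? pa)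
  (cong (g zero ∷_) (List.filter-none P? (All.tabulate⁺ λ i pi → Fin.0≢1+n (sym (unique (suc i) pi)))))
filter-tabulate-single P? g (suc a) pa unique = trans (List.filter-reject P? λ p0 → Fin.0≢1+n (unique zero p0))
  (filter-tabulate-single P? (λ i → g (suc i)) a pa (λ i pi → Fin.suc-injective (unique (suc i) pi)))

module CycleWord {n} (σ : Permutation′ (suc n)) (cycle : IsCycle σ) where
  open SingleCycle σ cycle

  word : ℕ → ℕ
  word k = toℕ (orbit k)

  open Word word public

  word-injective : ∀ {i j} → i < suc n → j < suc n → word i ≡ word j → i ≡ j
  word-injective i<N j<N eq = orbit-injective i<N j<N (Fin.toℕ-injective eq)

  word-first-max : ∀ {i} → i < suc n → word i ≤ word 0
  word-first-max {i} _ = toℕ≤top (orbit i)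

  next-word : ∀ {k} → k < suc n → next (suc n) k ≡ word (suc k)
  next-word {k} k<N with suc k <? suc n
  ... | yes k+1<N = next-inner k+1<N
  ... | no k+1≮N with suc-injective (≤-antisym k<N (≮⇒≥ k+1≮N))
  ...   | refl = trans (next-last n) (cong toℕ (sym orbit-period))

  sum-allFin : ∀ (F : Fin (suc n) → ℕ) → sum (map F (allFin (suc n))) ≡ ∑[ k < suc n ] F (orbit k)
  sum-allFin F = trans (cong sum (List.map-tabulate (λ i → i) F))
                       (sum-tabulate-reindex orbit orbit-injective orbit-surjective F)

  ℓS≡inversions : ℓS σ ≡ inversions (suc n)
  ℓS≡inversions = begin
      ℓS σ
    ≡⟨ sum-allFin (λ i → countᵇ (inverted i) (allFin (suc n))) ⟩
      ∑[ k < suc n ] countᵇ (inverted (orbit k)) (allFin (suc n))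
    ≡⟨ ∑-cong (suc n) (λ k _ → countᵇ-as-sum (inverted (orbit k)) (allFin (suc n))) ⟩
      ∑[ k < suc n ] sum (map (λ j → 𝟙 (inverted (orbit k) j)) (allFin (suc n)))
    ≡⟨ ∑-cong (suc n) (λ k _ → sum-allFin (λ j → 𝟙 (inverted (orbit k) j))) ⟩
      ∑[ k < suc n ] ∑[ l < suc n ] 𝟙 ((word k <ᵇ word l) ∧ (word (suc l) <ᵇ word (suc k)))
    ≡⟨ ∑-cong (suc n) (λ k k<N → ∑-cong (suc n) λ l l<N →
         cong₂ (λ u v → 𝟙 ((word k <ᵇ word l) ∧ (u <ᵇ v))) (sym (next-word l<N)) (sym (next-word k<N))) ⟩
      inversions (suc n)
    ∎
    where
    open ≡-Reasoning
    inverted : Fin (suc n) → Fin (suc n) → Bool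
    inverted i j = (toℕ i <ᵇ toℕ j) ∧ (toℕ (σ ⟨$⟩ʳ j) <ᵇ toℕ (σ ⟨$⟩ʳ i))

  countIn-word : ∀ u {v} → v ≤ suc n → countIn (suc n) u v ≡ v ∸ u
  countIn-word u {v} v≤N = begin
      ∑[ k < suc n ] 𝟙 (inInterval u v (word k))
    ≡⟨ sum-tabulate-reindex orbit orbit-injective orbit-surjective (λ i → 𝟙 (inInterval u v (toℕ i))) ⟨
      sum (tabulate {n = suc n} (λ i → 𝟙 (inInterval u v (toℕ i))))
    ≡⟨ sum-tabulate-toℕ (suc n) (λ w → 𝟙 (inInterval u v w)) ⟩
      ∑[ w < suc n ] 𝟙 (inInterval u v w)
    ≡⟨ count-interval (suc n) u v≤N ⟩
      v ∸ u
    ∎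
    where open ≡-Reasoning

  dp≡displacement : dp σ ≡ displacement (suc n)
  dp≡displacement = trans (sum-allFin (λ i → toℕ (σ ⟨$⟩ʳ i) ∸ toℕ i)) (∑-cong (suc n) λ k k<N → begin
      word (suc k) ∸ word k
    ≡⟨ countIn-word (word k) (<⇒≤ (Fin.toℕ<n (orbit (suc k)))) ⟨
      countIn (suc n) (word k) (word (suc k))
    ≡⟨ cong (countIn (suc n) (word k)) (next-word k<N) ⟨
      countIn (suc n) (word k) (next (suc n) k)
    ∎)
    where open ≡-Reasoning

  ℓT≡n : ℓT σ ≡ n
  ℓT≡n = cong (suc n ∸_) cycle

  Φ≡word : Φ σ ≡ applyUpTo word (suc n)
  Φ≡word = begin
      Φ σ
    ≡⟨ cong (λ ms → map toℕ (concatMap (cycleFrom σ) ms))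
            (filter-tabulate-single (λ m → isCycleMax σ m ≟ᵇ true) (λ i → i) top top-isCycleMax
                                    (λ i i-max → cycleMax-unique i-max top-isCycleMax)) ⟩
      map toℕ (cycleFrom σ top ++ [])
    ≡⟨ cong (map toℕ) (List.++-identityʳ (cycleFrom σ top)) ⟩
      map toℕ (top ∷ takeWhileᵇ notTop (map (λ k → orbit (suc k)) (upTo (suc n))))
    ≡⟨ cong (λ ks → map toℕ (top ∷ takeWhileᵇ notTop ks))
            (trans (List.map-applyUpTo (λ k → k) (λ k → orbit (suc k)) (suc n)) (sym (List.applyUpTo-∷ʳ _ n))) ⟩
      map toℕ (top ∷ takeWhileᵇ notTop (applyUpTo (λ k → orbit (suc k)) n ++ orbit (suc n) ∷ []))
    ≡⟨ cong (λ ks → map toℕ (top ∷ ks)) (takeWhileᵇ-applyUpTo notTop _ n inner-not-top last-top) ⟩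
      map toℕ (top ∷ applyUpTo (λ k → orbit (suc k)) n)
    ≡⟨ cong (toℕ top ∷_) (List.map-applyUpTo _ toℕ n) ⟩
      applyUpTo word (suc n)
    ∎
    where
    open ≡-Reasoning
    notTop : Fin (suc n) → Bool
    notTop i = not (eqFin i top)
    last-top : notTop (orbit (suc n)) ≡ false
    last-top = trans (cong notTop orbit-period) (cong not (≡ᵇ-refl (toℕ top)))
    inner-not-top : ∀ {k} → k < n → notTop (orbit (suc k)) ≡ true
    inner-not-top {k} k<n with eqFin (orbit (suc k)) top in is-top
    ... | false = refl
    ... | true = contradiction (orbit-injective (s<s k<n) z<s (eqFin⇒≡ is-top)) λ ()

  occurrences-Φ : ∀ s → countPairs (λ i j → s i j (at (Φ σ) i) (at (Φ σ) (suc i)) (at (Φ σ) j) (at (Φ σ) (suc j))) (Φ σ)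
                        ≡ occurrences s (suc n)
  occurrences-Φ s =
    trans (cong (λ τ → countPairs (λ i j → s i j (at τ i) (at τ (suc i)) (at τ j) (at τ (suc j))) τ) Φ≡word)
          (countPairs-applyUpTo s word (suc n))

  statistics-σ : ℓS σ ≡ n + 2 * (p2-31 (Φ σ) + p14-23 (Φ σ) + p41-32 (Φ σ))
               × dp σ ≡ n + (p2-31 (Φ σ) + p14-23 (Φ σ) + p41-32 (Φ σ) + p24-13 (Φ σ) + p31-42 (Φ σ))
  statistics-σ =
    let inversions≡ , displacement≡ = Growth.statistics (suc n) word-injective word-first-max n ≤-refl
    in trans ℓS≡inversions (trans inversions≡ (cong (λ t → n + 2 * t) threePatterns≡))
     , trans dp≡displacement (trans displacement≡ (cong (n +_) fivePatterns≡))
    where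
    threePatterns≡ : threePatterns (suc n) ≡ p2-31 (Φ σ) + p14-23 (Φ σ) + p41-32 (Φ σ)
    threePatterns≡ = sym (cong₂ _+_ (cong₂ _+_ (occurrences-Φ shape2-31) (occurrences-Φ shape14-23))
                                    (occurrences-Φ shape41-32))
    fivePatterns≡ : fivePatterns (suc n) ≡ p2-31 (Φ σ) + p14-23 (Φ σ) + p41-32 (Φ σ) + p24-13 (Φ σ) + p31-42 (Φ σ)
    fivePatterns≡ = cong₂ _+_ (cong₂ _+_ threePatterns≡ (sym (occurrences-Φ shape24-13))) (sym (occurrences-Φ shape31-42))

shallowness : ∀ a b c d e {ℓS dp ℓT n : ℕ} → ℓS ≡ n + 2 * (a + b + c) → dp ≡ n + (a + b + c + d + e) → ℓT ≡ n →
  2 * dp ≡ ℓS + ℓT + 2 * (e + d) × (2 * dp ≡ ℓS + ℓT ⇔ (e ≡ 0 × d ≡ 0))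
shallowness a b c d e {ℓS} {dp} {ℓT} {n} refl refl refl = excess , mk⇔ to from
  where
  excess : 2 * dp ≡ ℓS + ℓT + 2 * (e + d)
  excess = expand n a b c d e
    where
    expand : ∀ n a b c d e → 2 * (n + (a + b + c + d + e)) ≡ n + 2 * (a + b + c) + n + 2 * (e + d)
    expand = solve-∀
  to : 2 * dp ≡ ℓS + ℓT → e ≡ 0 × d ≡ 0
  to shallow = m+n≡0⇒m≡0 e e+d≡0 , m+n≡0⇒n≡0 e e+d≡0
    where
    e+d≡0 : e + d ≡ 0
    e+d≡0 = m+n≡0⇒m≡0 (e + d) (+-cancelˡ-≡ (ℓS + ℓT) _ _ (trans (sym excess) (trans shallow (sym (+-identityʳ _)))))
  from : e ≡ 0 × d ≡ 0 → 2 * dp ≡ ℓS + ℓT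
  from (refl , refl) = trans excess (+-identityʳ _)

corollary5p4 : (n : ℕ) (σ : Permutation′ n) → IsCycle σ →
    (ℓS σ ≡ n ∸ 1 + 2 * (p2-31 (Φ σ) + p14-23 (Φ σ) + p41-32 (Φ σ)))
    × (dp σ ≡ n ∸ 1 + (p2-31 (Φ σ) + p14-23 (Φ σ) + p41-32 (Φ σ) + p24-13 (Φ σ) + p31-42 (Φ σ)))
    × (2 * dp σ ≡ ℓS σ + ℓT σ + 2 * (p31-42 (Φ σ) + p24-13 (Φ σ)))
    × (IsShallow σ ⇔ (Avoids p31-42 (Φ σ) × Avoids p24-13 (Φ σ)))
corollary5p4 zero σ ()
corollary5p4 (suc n) σ cycle =
  let open CycleWord σ cycle
      ℓS-formula , dp-formula = statistics-σ
      excess , shallow⇔avoids = shallowness (p2-31 (Φ σ)) (p14-23 (Φ σ)) (p41-32 (Φ σ)) (p24-13 (Φ σ)) (p31-42 (Φ σ))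
                                            ℓS-formula dp-formula ℓT≡n
  in ℓS-formula , dp-formula , excess , shallow⇔avoids
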